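{- If $p_0, p_1, p_2 \in \mathbb{Z}_{\ge 0}$, then \[ \kappa_{p_0,p_1}(2) = F_{p_0+p_1+3} - F_{p_0} F_{p_1} = F_{p_0+p_1+2} + F_{p_0+p_1} + F_{p_0-1} F_{p_1-1}, \] \[ \kappa_{p_0,p_1}(3) = F_{p_0+p_1+3} + F_{p_0+p_1+1} - 2 F_{p_0+p_1-2} - 2 F_{p_0-2} F_{p_1-2}, \] \begin{align*} \kappa_{p_0,p_1,p_2}(2,2) &= \bigl(F_{p_0+p_1+p_2+4} + F_{p_0+p_1+p_2+2} - F_{p_0+p_1+p_2-4}\bigr) \\ &\quad - \bigl(F_{p_1}(F_{p_0-1} F_{p_2-1} + 3 F_{p_0-2} F_{p_2-1} + 3 F_{p_0-1} F_{p_2-2}) + 2 F_{p_0-2} F_{p_1+1} F_{p_2-2}\bigr). \end{align*}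
   Context: $F_n$ denotes the $n$th Fibonacci number, defined for all $n\in\mathbb{Z}$ by $F_0=0$, $F_1=1$, $F_n=F_{n-1}+F_{n-2}$. The continuants $K_d(X_1,\dotsc,X_d)$ are defined by $K_0 = 1$, $K_1(X_1) = X_1$, and $K_d(X_1,\dotsc,X_d) = X_d K_{d-1}(X_1,\dotsc,X_{d-1}) + K_{d-2}(X_1,\dotsc,X_{d-2})$ for $d\ge 2$; write $K(\underline{l})$ for the continuant of a tuple $\underline{l}$. For $s,p_0,\dotsc,p_s\in\mathbb{Z}_{\ge 0}$, $w_{p_0,\dotsc,p_s}(X_1,\dotsc,X_s)$ is the tuple consisting of $p_0$ ones, then $X_1$, then $p_1$ ones, then $X_2$, ..., then $X_s$, then $p_s$ ones; and $\kappa_{p_0,\dotsc,p_s}(X_1,\dotsc,X_s) = K(w_{p_0,\dotsc,p_s}(X_1,\dotsc,X_s))$. -}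

module Defs where

open import Data.Nat as ℕ using (ℕ; zero; suc)
open import Data.Integer as ℤ using (ℤ; +_; -[1+_]; _+_; _*_; _-_; -_)
open import Data.List as List using (List; []; _∷_; _++_; replicate; reverse)

fibℕ : ℕ → ℤ
fibℕ zero = + 0
fibℕ (suc zero) = + 1
fibℕ (suc (suc n)) = fibℕ (suc n) + fibℕ n

sgn : ℕ → ℤ
sgn zero = + 1
sgn (suc n) = - sgn n

-- Fibonacci numbers for all integer indices, extending F_n = F_{n-1} + F_{n-2}:
-- F_{-n} = (-1)^{n+1} F_n
F : ℤ → ℤ
F (+ n) = fibℕ n
F -[1+ n ] = sgn n * fibℕ (suc n)

-- Continuant K_d(X_1,...,X_d): K_0 = 1, K_1(X_1) = X_1,
-- K_d = X_d K_{d-1}(X_1..X_{d-1}) + K_{d-2}(X_1..X_{d-2}).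
-- contStep prev cur xs : with prev = K_{d-2}, cur = K_{d-1} of the prefix already
-- consumed, continue with the remaining entries xs. Starting values K_{-1} = 0, K_0 = 1
-- reproduce K_1(X_1) = X_1 * 1 + 0 = X_1.
contStep : ℤ → ℤ → List ℤ → ℤ
contStep prev cur [] = cur
contStep prev cur (x ∷ xs) = contStep cur (x * cur + prev) xs

K : List ℤ → ℤ
K xs = contStep (+ 0) (+ 1) xs

ones : ℕ → List ℤ
ones p = replicate p (+ 1)

w₁ : ℕ → ℕ → ℤ → List ℤ
w₁ p₀ p₁ X₁ = ones p₀ ++ (X₁ ∷ ones p₁)

w₂ : ℕ → ℕ → ℕ → ℤ → ℤ → List ℤ
w₂ p₀ p₁ p₂ X₁ X₂ = ones p₀ ++ (X₁ ∷ ones p₁) ++ (X₂ ∷ ones p₂)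

κ₁ : ℕ → ℕ → ℤ → ℤ
κ₁ p₀ p₁ X₁ = K (w₁ p₀ p₁ X₁)

κ₂ : ℕ → ℕ → ℕ → ℤ → ℤ → ℤ
κ₂ p₀ p₁ p₂ X₁ X₂ = K (w₂ p₀ p₁ p₂ X₁ X₂)

{-# OPTIONS --safe #-}
-- Appending a block of p ones to a word acts on the pair of its last two continuants by
-- the matrix of F (p - 1), F p, F (p + 1), so each κ is a polynomial in the F pᵢ and
-- F (pᵢ + 1). The addition law F (z + w) = F w F (z - 1) + F (w + 1) F z, which holds for
-- all integer indices because both sides solve the Fibonacci recurrence in w, brings the
-- right-hand sides into the same coordinates, and what remains are polynomial identities.
module Submission where

open import Defs
open import Data.Nat using (ℕ; zero; suc)
open import Data.Integer using (ℤ; +_; -[1+_]; _+_; _-_; _*_; -_)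
open import Data.Integer.Tactic.RingSolver using (solve-∀; solve)
open import Data.List using ([]; _∷_; _++_)
open import Data.List.Properties using (++-identityʳ)
open import Data.Product using (_×_; _,_; proj₁)
open import Relation.Binary.PropositionalEquality
  using (_≡_; refl; sym; trans; cong; cong₂; module ≡-Reasoning)

IsFibonacci : (ℤ → ℤ) → Set
IsFibonacci g = ∀ z → g (+ 2 + z) ≡ g (+ 1 + z) + g z

F-isFibonacci : IsFibonacci F
F-isFibonacci (+ n) = refl
F-isFibonacci -[1+ 0 ] = refl
F-isFibonacci -[1+ 1 ] = refl
F-isFibonacci -[1+ suc (suc n) ] = sign-identity (sgn n) (fibℕ n) (fibℕ (suc n))
  where
  sign-identity : ∀ σ f₀ f₁ → σ * f₁ ≡ - σ * (f₁ + f₀) + - - σ * ((f₁ + f₀) + f₁)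
  sign-identity = solve-∀

isFibonacci-shift : ∀ {g} → IsFibonacci g → ∀ c → IsFibonacci (λ w → g (c + w))
isFibonacci-shift {g} rec c z = begin
  g (c + (+ 2 + z))              ≡⟨ cong g (shift₂ c z) ⟩
  g (+ 2 + (c + z))              ≡⟨ rec (c + z) ⟩
  g (+ 1 + (c + z)) + g (c + z)  ≡⟨ cong (λ i → g i + g (c + z)) (shift₁ c z) ⟩
  g (c + (+ 1 + z)) + g (c + z)  ∎
  where
  open ≡-Reasoning
  shift₂ : ∀ c z → c + (+ 2 + z) ≡ + 2 + (c + z)
  shift₂ = solve-∀
  shift₁ : ∀ c z → + 1 + (c + z) ≡ c + (+ 1 + z)
  shift₁ = solve-∀

isFibonacci-combination : ∀ {g h} → IsFibonacci g → IsFibonacci h →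
  ∀ α β → IsFibonacci (λ w → g w * α + h w * β)
isFibonacci-combination {g} {h} recg rech α β z
  rewrite recg z | rech z = distribute (g (+ 1 + z)) (g z) (h (+ 1 + z)) (h z) α β
  where
  distribute : ∀ g₁ g₀ h₁ h₀ α β →
    (g₁ + g₀) * α + (h₁ + h₀) * β ≡ (g₁ * α + h₁ * β) + (g₀ * α + h₀ * β)
  distribute = solve-∀

isFibonacci-backward : ∀ {g} → IsFibonacci g → ∀ z → g z ≡ g (+ 2 + z) - g (+ 1 + z)
isFibonacci-backward {g} rec z rewrite rec z = cancel (g (+ 1 + z)) (g z)
  where
  cancel : ∀ x y → y ≡ (x + y) - x
  cancel = solve-∀

isFibonacci-unique : ∀ {g h} → IsFibonacci g → IsFibonacci h →
  g (+ 0) ≡ h (+ 0) → g (+ 1) ≡ h (+ 1) → ∀ z → g z ≡ h z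
isFibonacci-unique {g} {h} recg rech g₀≡h₀ g₁≡h₁ = agree
  where
  upwards : ∀ n → g (+ n) ≡ h (+ n) × g (+ suc n) ≡ h (+ suc n)
  upwards zero = g₀≡h₀ , g₁≡h₁
  upwards (suc n) with upwards n
  ... | gₙ≡hₙ , gₙ₊₁≡hₙ₊₁ = gₙ₊₁≡hₙ₊₁ , (begin
    g (+ 2 + + n)                 ≡⟨ recg (+ n) ⟩
    g (+ 1 + + n) + g (+ n)       ≡⟨ cong₂ _+_ gₙ₊₁≡hₙ₊₁ gₙ≡hₙ ⟩
    h (+ 1 + + n) + h (+ n)       ≡⟨ sym (rech (+ n)) ⟩
    h (+ 2 + + n)                 ∎)
    where open ≡-Reasoning

  step₂ : ∀ k → + 2 + - (+ 1 + k) ≡ + 1 - k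
  step₂ = solve-∀
  step₁ : ∀ k → + 1 + - (+ 1 + k) ≡ - k
  step₁ = solve-∀
  step₀ : ∀ k → + 1 - (+ 1 + k) ≡ - k
  step₀ = solve-∀

  backward : ∀ f → IsFibonacci f → ∀ k → f (- + suc k) ≡ f (+ 1 - + k) - f (- + k)
  backward f rec k = trans (isFibonacci-backward {f} rec (- + suc k))
    (cong₂ (λ i j → f i - f j) (step₂ (+ k)) (step₁ (+ k)))

  downwards : ∀ k → g (- + k) ≡ h (- + k) × g (+ 1 - + k) ≡ h (+ 1 - + k)
  downwards zero = g₀≡h₀ , g₁≡h₁
  downwards (suc k) with downwards k
  ... | g₋ₖ≡h₋ₖ , g₁₋ₖ≡h₁₋ₖ = (begin
    g (- + suc k)                ≡⟨ backward g recg k ⟩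
    g (+ 1 - + k) - g (- + k)    ≡⟨ cong₂ _-_ g₁₋ₖ≡h₁₋ₖ g₋ₖ≡h₋ₖ ⟩
    h (+ 1 - + k) - h (- + k)    ≡⟨ sym (backward h rech k) ⟩
    h (- + suc k)                ∎)
    , trans (cong g (step₀ (+ k))) (trans g₋ₖ≡h₋ₖ (sym (cong h (step₀ (+ k)))))
    where open ≡-Reasoning

  agree : ∀ z → g z ≡ h z
  agree (+ n) = proj₁ (upwards n)
  agree -[1+ n ] = proj₁ (downwards (suc n))

-- F (1 + z) - F z stands for F (z - 1).
F-+ : ∀ z w → F (z + w) ≡ F w * (F (+ 1 + z) - F z) + F (+ 1 + w) * F z
F-+ z = isFibonacci-unique
  (isFibonacci-shift {F} F-isFibonacci z)
  (isFibonacci-combination {F} {λ w → F (+ 1 + w)}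
    F-isFibonacci (isFibonacci-shift {F} F-isFibonacci (+ 1)) (F (+ 1 + z) - F z) (F z))
  (trans (cong F (right-unit z)) (at-0 (F (+ 1 + z)) (F z)))
  (trans (cong F (right-one z)) (at-1 (F (+ 1 + z)) (F z)))
  where
  right-unit : ∀ z → z + + 0 ≡ z
  right-unit = solve-∀
  right-one : ∀ z → z + + 1 ≡ + 1 + z
  right-one = solve-∀
  at-0 : ∀ x₁ x₀ → x₀ ≡ + 0 * (x₁ - x₀) + + 1 * x₀
  at-0 = solve-∀
  at-1 : ∀ x₁ x₀ → x₁ ≡ + 1 * (x₁ - x₀) + + 1 * x₀
  at-1 = solve-∀

-- The arguments u, v of contStep are K_{d-1}, K_d; F (1 + p) - F p stands for F (p - 1).
contStep-ones-++ : ∀ p u v xs → contStep u v (ones p ++ xs) ≡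
  contStep ((F (+ 1 + + p) - F (+ p)) * u + F (+ p) * v) (F (+ p) * u + F (+ 1 + + p) * v) xs
contStep-ones-++ zero u v xs = cong₂ (λ u′ v′ → contStep u′ v′ xs) (prev u v) (cur u v)
  where
  prev : ∀ u v → u ≡ (+ 1 - + 0) * u + + 0 * v
  prev = solve-∀
  cur : ∀ u v → v ≡ + 0 * u + + 1 * v
  cur = solve-∀
contStep-ones-++ (suc p) u v xs = trans (contStep-ones-++ p v (+ 1 * v + u) xs)
  (cong₂ (λ u′ v′ → contStep u′ v′ xs)
    (prev (F (+ p)) (F (+ 1 + + p)) u v) (cur (F (+ p)) (F (+ 1 + + p)) u v))
  where
  prev : ∀ f₀ f₁ u v → (f₁ - f₀) * v + f₀ * (+ 1 * v + u) ≡ ((f₁ + f₀) - f₁) * u + f₁ * v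
  prev = solve-∀
  cur : ∀ f₀ f₁ u v → f₀ * v + f₁ * (+ 1 * v + u) ≡ f₁ * u + (f₁ + f₀) * v
  cur = solve-∀

contStep-ones : ∀ p u v → contStep u v (ones p) ≡ F (+ p) * u + F (+ 1 + + p) * v
contStep-ones p u v =
  trans (cong (contStep u v) (sym (++-identityʳ (ones p)))) (contStep-ones-++ p u v [])

K-ones-++ : ∀ p xs → K (ones p ++ xs) ≡ contStep (F (+ p)) (F (+ 1 + + p)) xs
K-ones-++ p xs = trans (contStep-ones-++ p (+ 0) (+ 1) xs)
  (cong₂ (λ u v → contStep u v xs)
    (unit (F (+ 1 + + p) - F (+ p)) (F (+ p))) (unit (F (+ p)) (F (+ 1 + + p))))
  where
  unit : ∀ x y → x * + 0 + y * + 1 ≡ y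
  unit = solve-∀

κ₁-closed : ∀ a b X →
  κ₁ a b X ≡ F (+ b) * F (+ 1 + + a) + F (+ 1 + + b) * (X * F (+ 1 + + a) + F (+ a))
κ₁-closed a b X = trans (K-ones-++ a (X ∷ ones b)) (contStep-ones b _ _)

κ₂-closed : ∀ a b c X Y →
  let u = F (+ 1 + + a)
      v = X * u + F (+ a)
      k₋ = (F (+ 1 + + b) - F (+ b)) * u + F (+ b) * v
      k = F (+ b) * u + F (+ 1 + + b) * v
  in κ₂ a b c X Y ≡ F (+ c) * k + F (+ 1 + + c) * (Y * k + k₋)
κ₂-closed a b c X Y = trans (K-ones-++ a _) (trans (contStep-ones-++ b _ _ _) (contStep-ones c _ _))

-- For x among a, b, c, s = a + b and r = a + b + c, the variable xₖ stands for F (x + k)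
-- (k possibly negative), x₁ for F (1 + x) and x₁′ for F (x + 1). Each hypothesis is an
-- instance of F-+; stating them as equations leaves the ring solver with plain variables.
κ₁-2-identity : ∀ a₀ a₁ b₀ b₁ {s₀ s₁ s₃} →
  s₀ ≡ b₀ * (a₁ - a₀) + b₁ * a₀ →
  s₁ ≡ b₀ * ((a₁ + a₀) - a₁) + b₁ * a₁ →
  s₃ ≡ + 2 * (s₁ - s₀) + + 3 * s₀ →
  b₀ * a₁ + b₁ * (+ 2 * a₁ + a₀) ≡ s₃ - a₀ * b₀
κ₁-2-identity a₀ a₁ b₀ b₁ refl refl refl = solve (a₀ ∷ a₁ ∷ b₀ ∷ b₁ ∷ [])

κ₁-2-identity′ : ∀ a₀ a₁ b₀ b₁ {s₀ s₁ s₂ s₃ a₋₁ b₋₁} →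
  s₀ ≡ b₀ * (a₁ - a₀) + b₁ * a₀ →
  s₁ ≡ b₀ * ((a₁ + a₀) - a₁) + b₁ * a₁ →
  s₂ ≡ + 1 * (s₁ - s₀) + + 2 * s₀ →
  s₃ ≡ + 2 * (s₁ - s₀) + + 3 * s₀ →
  a₋₁ ≡ + 1 * (a₁ - a₀) + + 0 * a₀ →
  b₋₁ ≡ + 1 * (b₁ - b₀) + + 0 * b₀ →
  s₃ - a₀ * b₀ ≡ s₂ + s₀ + a₋₁ * b₋₁
κ₁-2-identity′ a₀ a₁ b₀ b₁ refl refl refl refl refl refl = solve (a₀ ∷ a₁ ∷ b₀ ∷ b₁ ∷ [])

κ₁-3-identity : ∀ a₀ a₁ b₀ b₁ {s₀ s₁ s₁′ s₃ s₋₂ a₋₂ b₋₂} →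
  s₀ ≡ b₀ * (a₁ - a₀) + b₁ * a₀ →
  s₁ ≡ b₀ * ((a₁ + a₀) - a₁) + b₁ * a₁ →
  s₁′ ≡ + 1 * (s₁ - s₀) + + 1 * s₀ →
  s₃ ≡ + 2 * (s₁ - s₀) + + 3 * s₀ →
  s₋₂ ≡ - + 1 * (s₁ - s₀) + + 1 * s₀ →
  a₋₂ ≡ - + 1 * (a₁ - a₀) + + 1 * a₀ →
  b₋₂ ≡ - + 1 * (b₁ - b₀) + + 1 * b₀ →
  b₀ * a₁ + b₁ * (+ 3 * a₁ + a₀) ≡ s₃ + s₁′ - + 2 * s₋₂ - + 2 * a₋₂ * b₋₂
κ₁-3-identity a₀ a₁ b₀ b₁ refl refl refl refl refl refl refl = solve (a₀ ∷ a₁ ∷ b₀ ∷ b₁ ∷ [])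

κ₂-2-2-identity : ∀ a₀ a₁ b₀ b₁ c₀ c₁ {s₀ s₁ r₀ r₁ r₂ r₄ r₋₄ a₋₁ a₋₂ c₋₁ c₋₂ b₁′} →
  s₀ ≡ b₀ * (a₁ - a₀) + b₁ * a₀ →
  s₁ ≡ b₀ * ((a₁ + a₀) - a₁) + b₁ * a₁ →
  r₀ ≡ c₀ * (s₁ - s₀) + c₁ * s₀ →
  r₁ ≡ c₀ * ((s₁ + s₀) - s₁) + c₁ * s₁ →
  r₂ ≡ + 1 * (r₁ - r₀) + + 2 * r₀ →
  r₄ ≡ + 3 * (r₁ - r₀) + + 5 * r₀ →
  r₋₄ ≡ - + 3 * (r₁ - r₀) + + 2 * r₀ →
  a₋₁ ≡ + 1 * (a₁ - a₀) + + 0 * a₀ →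
  a₋₂ ≡ - + 1 * (a₁ - a₀) + + 1 * a₀ →
  c₋₁ ≡ + 1 * (c₁ - c₀) + + 0 * c₀ →
  c₋₂ ≡ - + 1 * (c₁ - c₀) + + 1 * c₀ →
  b₁′ ≡ + 1 * (b₁ - b₀) + + 1 * b₀ →
  let k₋ = (b₁ - b₀) * a₁ + b₀ * (+ 2 * a₁ + a₀)
      k = b₀ * a₁ + b₁ * (+ 2 * a₁ + a₀)
  in c₀ * k + c₁ * (+ 2 * k + k₋)
     ≡ (r₄ + r₂ - r₋₄)
       - (b₀ * (a₋₁ * c₋₁ + + 3 * a₋₂ * c₋₁ + + 3 * a₋₁ * c₋₂) + + 2 * a₋₂ * b₁′ * c₋₂)
κ₂-2-2-identity a₀ a₁ b₀ b₁ c₀ c₁ refl refl refl refl refl refl refl refl refl refl refl refl =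
  solve (a₀ ∷ a₁ ∷ b₀ ∷ b₁ ∷ c₀ ∷ c₁ ∷ [])

lemma5p1 : (p₀ p₁ p₂ : ℕ) →
      (κ₁ p₀ p₁ (+ 2) ≡ F (+ p₀ + + p₁ + + 3) - F (+ p₀) * F (+ p₁))
    × (F (+ p₀ + + p₁ + + 3) - F (+ p₀) * F (+ p₁)
        ≡ F (+ p₀ + + p₁ + + 2) + F (+ p₀ + + p₁) + F (+ p₀ - + 1) * F (+ p₁ - + 1))
    × (κ₁ p₀ p₁ (+ 3)
        ≡ F (+ p₀ + + p₁ + + 3) + F (+ p₀ + + p₁ + + 1) - + 2 * F (+ p₀ + + p₁ - + 2)
          - + 2 * F (+ p₀ - + 2) * F (+ p₁ - + 2))
    × (κ₂ p₀ p₁ p₂ (+ 2) (+ 2)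
        ≡ (F (+ p₀ + + p₁ + + p₂ + + 4) + F (+ p₀ + + p₁ + + p₂ + + 2)
            - F (+ p₀ + + p₁ + + p₂ - + 4))
          - (F (+ p₁) * (F (+ p₀ - + 1) * F (+ p₂ - + 1) + + 3 * F (+ p₀ - + 2) * F (+ p₂ - + 1)
                + + 3 * F (+ p₀ - + 1) * F (+ p₂ - + 2))
             + + 2 * F (+ p₀ - + 2) * F (+ p₁ + + 1) * F (+ p₂ - + 2)))
lemma5p1 a b c =
    trans (κ₁-closed a b (+ 2))
      (κ₁-2-identity a₀ a₁ b₀ b₁ (F-+ (+ a) (+ b)) (F-+ (+ 1 + + a) (+ b)) (F-+ s (+ 3)))
  , κ₁-2-identity′ a₀ a₁ b₀ b₁ (F-+ (+ a) (+ b)) (F-+ (+ 1 + + a) (+ b))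
      (F-+ s (+ 2)) (F-+ s (+ 3)) (F-+ (+ a) (- + 1)) (F-+ (+ b) (- + 1))
  , trans (κ₁-closed a b (+ 3))
      (κ₁-3-identity a₀ a₁ b₀ b₁ (F-+ (+ a) (+ b)) (F-+ (+ 1 + + a) (+ b))
        (F-+ s (+ 1)) (F-+ s (+ 3)) (F-+ s (- + 2)) (F-+ (+ a) (- + 2)) (F-+ (+ b) (- + 2)))
  , trans (κ₂-closed a b c (+ 2) (+ 2))
      (κ₂-2-2-identity a₀ a₁ b₀ b₁ c₀ c₁ (F-+ (+ a) (+ b)) (F-+ (+ 1 + + a) (+ b))
        (F-+ s (+ c)) (F-+ (+ 1 + s) (+ c)) (F-+ r (+ 2)) (F-+ r (+ 4)) (F-+ r (- + 4))
        (F-+ (+ a) (- + 1)) (F-+ (+ a) (- + 2)) (F-+ (+ c) (- + 1)) (F-+ (+ c) (- + 2))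
        (F-+ (+ b) (+ 1)))
  where
  a₀ a₁ b₀ b₁ c₀ c₁ s r : ℤ
  a₀ = F (+ a)
  a₁ = F (+ 1 + + a)
  b₀ = F (+ b)
  b₁ = F (+ 1 + + b)
  c₀ = F (+ c)
  c₁ = F (+ 1 + + c)
  s = + a + + b
  r = s + + c
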